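{- Let $m\ge 1$ and let $a^1=(a^1_1,\dots,a^1_m)\in\mathbb{N}^{m}$ be any initial state (entries are nonnegative integers). Then there is no infinite sequence of moves $a^1,a^2,a^3,\dots$: every sequence of moves starting from $a^1$, continued for as long as a move is possible, reaches a final state after finitely many moves.
   Context: A state is a tuple $a=(a_1,\dots,a_m)$ of nonnegative integers (it encodes the gap lengths between $m+1$ violinists in consecutive order). A move from a state $a$ to a state $a'$ is performed as follows: choose a triggering position $T\in\{1,\dots,m\}$ with $a_T=0$; set $a'_T=2$; if there exists $j<T$ with $a_j>0$, take the largest such $j$ and set $a'_j=a_j-1$; if there exists $j>T$ with $a_j>0$, take the smallest such $j$ and set $a'_j=a_j-1$; all other entries are unchanged. A sequence of moves is a sequence of states $a^1,a^2,\dots$ where each $a^{t+1}$ is obtained from $a^t$ by a move. A state is final if no move is possible, i.e. it contains no entry equal to $0$. -}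

module Defs where

open import Data.Nat using (ℕ; zero; suc; _<_; _∸_)
open import Data.Fin using (Fin; toℕ)
open import Data.Vec.Functional using (Vector)
open import Data.Product using (Σ; _×_)
open import Data.Sum using (_⊎_)
open import Relation.Binary.PropositionalEquality using (_≡_; _≢_)
open import Relation.Nullary using (¬_)

-- A state: gap lengths a = (a_1,…,a_m), positions indexed by Fin m.
State : ℕ → Set
State m = Vector ℕ m

LeftNbr : ∀ {m} → State m → Fin m → Fin m → Set
LeftNbr a T i =
  (toℕ i < toℕ T) × (0 < a i) ×
  (∀ j → toℕ i < toℕ j → toℕ j < toℕ T → a j ≡ 0)

RightNbr : ∀ {m} → State m → Fin m → Fin m → Set
RightNbr a T i =
  (toℕ T < toℕ i) × (0 < a i) ×
  (∀ j → toℕ T < toℕ j → toℕ j < toℕ i → a j ≡ 0)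

MoveAt : ∀ {m} → State m → Fin m → State m → Set
MoveAt a T a' =
  (a T ≡ 0) ×
  (a' T ≡ 2) ×
  (∀ i → LeftNbr a T i ⊎ RightNbr a T i → a' i ≡ a i ∸ 1) ×
  (∀ i → i ≢ T → ¬ LeftNbr a T i → ¬ RightNbr a T i → a' i ≡ a i)

Move : ∀ {m} → State m → State m → Set
Move a a' = Σ (Fin _) (λ T → MoveAt a T a')

InfiniteMoveSeq : ∀ {m} → State m → Set
InfiniteMoveSeq {m} a =
  Σ (ℕ → State m) (λ s → (s 0 ≡ a) × (∀ t → Move (s t) (s (suc t))))

-- Weight position i by W i = 2^(m+1) − 2^i, so every weight lies in [2^m, 2^(m+1)).
-- A move raises a_T from 0 to 2, gaining 2 W_T ≥ 2^(m+1), and lowers at most one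
-- entry on each side of T by one. A single neighbour costs less than 2^(m+1); two
-- neighbours j < T < k cost W_j + W_k, which is less than 2 W_T because
-- 2^j + 2^k > 2^k ≥ 2 · 2^T. Hence the potential Φ(a) = Σ W_i a_i strictly increases
-- along moves. On the other hand no entry ever exceeds max(a¹_i, 2), so Φ is bounded
-- along any sequence of moves, which therefore cannot be infinite.
module Submission where

open import Defs
open import Data.Nat using (ℕ; _≤_; zero; suc; _+_; _*_; _∸_; _^_; _<_; _⊔_; z≤n; s≤s; _<?_)
open import Data.Nat.Properties
open import Algebra.Properties.CommutativeSemigroup +-commutativeSemigroup
  using (interchange)
open import Algebra.Properties.CommutativeMonoid.Sum +-0-commutativeMonoid
  using (sum; sum-cong-≗; ∑-distrib-+; sum-replicate-zero)
open import Data.Fin using (Fin; toℕ) renaming (zero to fzero; suc to fsuc)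
open import Data.Fin.Properties using (toℕ-injective; toℕ≤n; any?; all?)
  renaming (_≟_ to _≟ᶠ_)
open import Data.Vec.Functional using (Vector)
open import Data.Maybe using (Maybe; just; nothing; maybe′)
open import Data.Product using (∃; _×_; _,_; proj₁; proj₂)
open import Data.Sum using (inj₁; inj₂)
open import Data.Empty using (⊥-elim)
open import Relation.Nullary using (¬_; Dec; yes; no)
open import Relation.Nullary.Decidable using (_×-dec_; _→-dec_)
open import Relation.Binary.PropositionalEquality
open import Relation.Binary.Definitions using (tri<; tri≈; tri>)

private
  variable
    n : ℕ

<-by-balance : ∀ {x u y v} → x + u ≡ y + v → v < u → x < y
<-by-balance {x} {u} {y} {v} balance v<u = +-cancelʳ-< u x y (begin-strict
  x + u ≡⟨ balance ⟩
  y + v <⟨ +-monoʳ-< y v<u ⟩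
  y + u ∎)
  where open ≤-Reasoning

2^[1+m]≡2^m+2^m : ∀ m → 2 ^ suc m ≡ 2 ^ m + 2 ^ m
2^[1+m]≡2^m+2^m m = cong (2 ^ m +_) (+-identityʳ (2 ^ m))

weight : ℕ → ℕ → ℕ
weight m i = 2 ^ suc m ∸ 2 ^ i

weight+2^i : ∀ {m i} → i ≤ m → weight m i + 2 ^ i ≡ 2 ^ suc m
weight+2^i i≤m = m∸n+n≡m (^-monoʳ-≤ 2 (m≤n⇒m≤1+n i≤m))

weight<2^[1+m] : ∀ {m i} → i ≤ m → weight m i < 2 ^ suc m
weight<2^[1+m] {m} {i} i≤m = ∸-monoʳ-< (m^n>0 2 i) (^-monoʳ-≤ 2 (m≤n⇒m≤1+n i≤m))

2^m≤weight : ∀ {m i} → i ≤ m → 2 ^ m ≤ weight m i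
2^m≤weight {m} {i} i≤m = m+n≤o⇒m≤o∸n (2 ^ m) (begin
  2 ^ m + 2 ^ i ≤⟨ +-monoʳ-≤ (2 ^ m) (^-monoʳ-≤ 2 i≤m) ⟩
  2 ^ m + 2 ^ m ≡⟨ 2^[1+m]≡2^m+2^m m ⟨
  2 ^ suc m     ∎)
  where open ≤-Reasoning

2^[1+m]≤weight+weight : ∀ {m i} → i ≤ m → 2 ^ suc m ≤ weight m i + weight m i
2^[1+m]≤weight+weight {m} {i} i≤m = subst (_≤ weight m i + weight m i)
  (sym (2^[1+m]≡2^m+2^m m)) (+-mono-≤ (2^m≤weight i≤m) (2^m≤weight i≤m))

weight-neighbours< : ∀ {m j T k} → j < T → T < k → k ≤ m →
  weight m j + weight m k < weight m T + weight m T
weight-neighbours< {m} {j} {T} {k} j<T T<k k≤m = <-by-balance balance 2^T+2^T<2^j+2^k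
  where
  open ≤-Reasoning
  T≤m : T ≤ m
  T≤m = <⇒≤ (<-≤-trans T<k k≤m)
  balance : weight m j + weight m k + (2 ^ j + 2 ^ k) ≡ weight m T + weight m T + (2 ^ T + 2 ^ T)
  balance = begin-equality
    weight m j + weight m k + (2 ^ j + 2 ^ k)
      ≡⟨ interchange (weight m j) _ _ _ ⟩
    (weight m j + 2 ^ j) + (weight m k + 2 ^ k)
      ≡⟨ cong₂ _+_ (weight+2^i (<⇒≤ (<-≤-trans j<T T≤m))) (weight+2^i k≤m) ⟩
    2 ^ suc m + 2 ^ suc m
      ≡⟨ cong₂ _+_ (weight+2^i T≤m) (weight+2^i T≤m) ⟨
    (weight m T + 2 ^ T) + (weight m T + 2 ^ T)
      ≡⟨ interchange (weight m T) _ _ _ ⟩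
    weight m T + weight m T + (2 ^ T + 2 ^ T)
      ∎
  2^T+2^T<2^j+2^k : 2 ^ T + 2 ^ T < 2 ^ j + 2 ^ k
  2^T+2^T<2^j+2^k = begin-strict
    2 ^ T + 2 ^ T ≡⟨ 2^[1+m]≡2^m+2^m T ⟨
    2 ^ suc T     ≤⟨ ^-monoʳ-≤ 2 T<k ⟩
    2 ^ k         <⟨ m<n+m (2 ^ k) (m^n>0 2 j) ⟩
    2 ^ j + 2 ^ k ∎

⟨_,_⟩ : Vector ℕ n → Vector ℕ n → ℕ
⟨ w , v ⟩ = sum (λ i → w i * v i)

⟨⟩-cong : ∀ (w : Vector ℕ n) {u v} → (∀ i → u i ≡ v i) → ⟨ w , u ⟩ ≡ ⟨ w , v ⟩
⟨⟩-cong w u≗v = sum-cong-≗ (λ i → cong (w i *_) (u≗v i))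

⟨⟩-distrib-+ : ∀ (w u v : Vector ℕ n) →
  ⟨ w , (λ i → u i + v i) ⟩ ≡ ⟨ w , u ⟩ + ⟨ w , v ⟩
⟨⟩-distrib-+ w u v =
  trans (sum-cong-≗ (λ i → *-distribˡ-+ (w i) (u i) (v i)))
        (∑-distrib-+ (λ i → w i * u i) (λ i → w i * v i))

⟨⟩-monoʳ-≤ : ∀ (w : Vector ℕ n) {u v} → (∀ i → u i ≤ v i) → ⟨ w , u ⟩ ≤ ⟨ w , v ⟩
⟨⟩-monoʳ-≤ {zero}  w u≤v = z≤n
⟨⟩-monoʳ-≤ {suc n} w u≤v =
  +-mono-≤ (*-monoʳ-≤ (w fzero) (u≤v fzero))
           (⟨⟩-monoʳ-≤ (λ i → w (fsuc i)) (λ i → u≤v (fsuc i)))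

δ : Fin n → Vector ℕ n
δ fzero    fzero    = 1
δ fzero    (fsuc _) = 0
δ (fsuc _) fzero    = 0
δ (fsuc j) (fsuc i) = δ j i

δ-diag : ∀ (i : Fin n) → δ i i ≡ 1
δ-diag fzero    = refl
δ-diag (fsuc i) = δ-diag i

δ-offDiag : ∀ {j i : Fin n} → j ≢ i → δ j i ≡ 0
δ-offDiag {j = fzero}  {fzero}  j≢i = ⊥-elim (j≢i refl)
δ-offDiag {j = fzero}  {fsuc i} j≢i = refl
δ-offDiag {j = fsuc j} {fzero}  j≢i = refl
δ-offDiag {j = fsuc j} {fsuc i} j≢i = δ-offDiag (λ j≡i → j≢i (cong fsuc j≡i))

⟨⟩-δ : ∀ (w : Vector ℕ n) j → ⟨ w , δ j ⟩ ≡ w j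
⟨⟩-δ {suc n} w fzero = begin
  w fzero * 1 + sum (λ i → w (fsuc i) * 0) ≡⟨ cong₂ _+_ (*-identityʳ (w fzero)) ∑0 ⟩
  w fzero + 0                              ≡⟨ +-identityʳ (w fzero) ⟩
  w fzero                                  ∎
  where
  open ≡-Reasoning
  ∑0 : sum (λ i → w (fsuc i) * 0) ≡ 0
  ∑0 = trans (sum-cong-≗ (λ i → *-zeroʳ (w (fsuc i)))) (sum-replicate-zero n)
⟨⟩-δ w (fsuc j) = trans (cong (_+ ⟨ (λ i → w (fsuc i)) , δ j ⟩) (*-zeroʳ (w fzero)))
                        (⟨⟩-δ (λ i → w (fsuc i)) j)

δ? : Maybe (Fin n) → Vector ℕ n
δ? nothing  _ = 0
δ? (just j) i = δ j i

⟨⟩-δ? : ∀ (w : Vector ℕ n) o → ⟨ w , δ? o ⟩ ≡ maybe′ w 0 o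
⟨⟩-δ? {n} w nothing  = trans (sum-cong-≗ (λ i → *-zeroʳ (w i))) (sum-replicate-zero n)
⟨⟩-δ? w (just j) = ⟨⟩-δ w j

Picks : (Fin n → Set) → Maybe (Fin n) → Set
Picks P o = ∀ i → (P i → o ≡ just i) × (o ≡ just i → P i)

pick : ∀ {P : Fin n → Set} → (∀ i → Dec (P i)) → (∀ {i i′} → P i → P i′ → i ≡ i′) →
       ∃ (Picks P)
pick P? unique with any? P?
... | yes (j , Pj) = just j , λ i → (λ Pi → cong just (unique Pj Pi)) , λ { refl → Pj }
... | no ¬∃P       = nothing , λ i → (λ Pi → ⊥-elim (¬∃P (i , Pi))) , λ ()

δ?-picked : ∀ {P : Fin n → Set} {o} → Picks P o → ∀ {i} → P i → δ? o i ≡ 1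
δ?-picked picks {i} Pi rewrite proj₁ (picks i) Pi = δ-diag i

δ?-unpicked : ∀ {P : Fin n → Set} {o} → Picks P o → ∀ {i} → ¬ P i → δ? o i ≡ 0
δ?-unpicked {o = nothing} picks ¬Pi = refl
δ?-unpicked {o = just j}  picks {i} ¬Pi =
  δ-offDiag (λ j≡i → ¬Pi (proj₂ (picks i) (cong just j≡i)))

module Neighbours {m} (a : State m) (T : Fin m) where

  leftNbr? : ∀ i → Dec (LeftNbr a T i)
  leftNbr? i = (toℕ i <? toℕ T) ×-dec (0 <? a i) ×-dec
    all? (λ j → (toℕ i <? toℕ j) →-dec (toℕ j <? toℕ T) →-dec (a j ≟ 0))

  rightNbr? : ∀ i → Dec (RightNbr a T i)
  rightNbr? i = (toℕ T <? toℕ i) ×-dec (0 <? a i) ×-dec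
    all? (λ j → (toℕ T <? toℕ j) →-dec (toℕ j <? toℕ i) →-dec (a j ≟ 0))

  leftNbr-unique : ∀ {i i′} → LeftNbr a T i → LeftNbr a T i′ → i ≡ i′
  leftNbr-unique {i} {i′} (i<T , 0<ai , gapᵢ) (i′<T , 0<ai′ , gapᵢ′) with <-cmp (toℕ i) (toℕ i′)
  ... | tri< i<i′ _ _ = ⊥-elim (>⇒≢ 0<ai′ (gapᵢ i′ i<i′ i′<T))
  ... | tri≈ _ i≡i′ _ = toℕ-injective i≡i′
  ... | tri> _ _ i′<i = ⊥-elim (>⇒≢ 0<ai (gapᵢ′ i i′<i i<T))

  rightNbr-unique : ∀ {i i′} → RightNbr a T i → RightNbr a T i′ → i ≡ i′
  rightNbr-unique {i} {i′} (T<i , 0<ai , gapᵢ) (T<i′ , 0<ai′ , gapᵢ′) with <-cmp (toℕ i) (toℕ i′)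
  ... | tri< i<i′ _ _ = ⊥-elim (>⇒≢ 0<ai (gapᵢ′ i T<i i<i′))
  ... | tri≈ _ i≡i′ _ = toℕ-injective i≡i′
  ... | tri> _ _ i′<i = ⊥-elim (>⇒≢ 0<ai′ (gapᵢ i′ T<i′ i′<i))

  left : ∃ (Picks (LeftNbr a T))
  left = pick leftNbr? leftNbr-unique

  right : ∃ (Picks (RightNbr a T))
  right = pick rightNbr? rightNbr-unique

moveAt-balance : ∀ {m} {a a′ : State m} {T oL oR} → MoveAt a T a′ →
  Picks (LeftNbr a T) oL → Picks (RightNbr a T) oR →
  ∀ i → a′ i + δ? oL i + δ? oR i ≡ a i + (δ T i + δ T i)
moveAt-balance {a = a} {a′} {T} (aT≡0 , a′T≡2 , nbr-dec , rest) pickL pickR i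
  with i ≟ᶠ T
... | yes refl rewrite aT≡0 | a′T≡2 | δ-diag T
                     | δ?-unpicked pickL (λ (T<T , _) → <-irrefl refl T<T)
                     | δ?-unpicked pickR (λ (T<T , _) → <-irrefl refl T<T) = refl
... | no i≢T rewrite δ-offDiag {j = T} {i} (≢-sym i≢T) | +-identityʳ (a i)
  with Neighbours.leftNbr? a T i | Neighbours.rightNbr? a T i
...   | yes l@(i<T , 0<ai , _) | _
  rewrite δ?-picked pickL l | δ?-unpicked pickR (λ (T<i , _) → <-asym i<T T<i)
        | nbr-dec i (inj₁ l) = trans (+-identityʳ _) (m∸n+n≡m 0<ai)
...   | no ¬l | yes r@(_ , 0<ai , _)
  rewrite δ?-unpicked pickL ¬l | δ?-picked pickR r
        | nbr-dec i (inj₂ r) = trans (cong (_+ 1) (+-identityʳ _)) (m∸n+n≡m 0<ai)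
...   | no ¬l | no ¬r
  rewrite δ?-unpicked pickL ¬l | δ?-unpicked pickR ¬r
        | rest i i≢T ¬l ¬r = trans (+-identityʳ _) (+-identityʳ _)

W : ∀ {m} → Vector ℕ m
W {m} i = weight m (toℕ i)

Φ : ∀ {m} → State m → ℕ
Φ a = ⟨ W , a ⟩

W<W+W : ∀ {m} (i T : Fin m) → W i < W T + W T
W<W+W i T = <-≤-trans (weight<2^[1+m] (toℕ≤n i)) (2^[1+m]≤weight+weight (toℕ≤n T))

neighbourLoss< : ∀ {m} (T : Fin m) (oL oR : Maybe (Fin m)) →
  (∀ {j} → oL ≡ just j → toℕ j < toℕ T) → (∀ {k} → oR ≡ just k → toℕ T < toℕ k) →
  maybe′ W 0 oL + maybe′ W 0 oR < W T + W T
neighbourLoss< T nothing  nothing  _   _   = ≤-<-trans z≤n (W<W+W T T)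
neighbourLoss< T (just j) nothing  _   _   =
  subst (_< W T + W T) (sym (+-identityʳ (W j))) (W<W+W j T)
neighbourLoss< T nothing  (just k) _   _   = W<W+W k T
neighbourLoss< T (just j) (just k) j<T T<k =
  weight-neighbours< (j<T refl) (T<k refl) (toℕ≤n k)

module _ {m} {a a′ : State m} {T : Fin m} (move : MoveAt a T a′) where

  open Neighbours a T using (left; right)

  moveAt-Φ< : Φ a < Φ a′
  moveAt-Φ< with left | right
  ... | oL , pickL | oR , pickR = <-by-balance (sym balance) (neighbourLoss< T oL oR j<T T<k)
    where
    open ≡-Reasoning
    j<T : ∀ {j} → oL ≡ just j → toℕ j < toℕ T
    j<T {j} oL≡j = proj₁ (proj₂ (pickL j) oL≡j)
    T<k : ∀ {k} → oR ≡ just k → toℕ T < toℕ k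
    T<k {k} oR≡k = proj₁ (proj₂ (pickR k) oR≡k)
    balance : Φ a′ + (maybe′ W 0 oL + maybe′ W 0 oR) ≡ Φ a + (W T + W T)
    balance = begin
      Φ a′ + (maybe′ W 0 oL + maybe′ W 0 oR)
        ≡⟨ cong₂ (λ x y → Φ a′ + (x + y)) (⟨⟩-δ? W oL) (⟨⟩-δ? W oR) ⟨
      Φ a′ + (⟨ W , δ? oL ⟩ + ⟨ W , δ? oR ⟩)
        ≡⟨ +-assoc (Φ a′) _ _ ⟨
      Φ a′ + ⟨ W , δ? oL ⟩ + ⟨ W , δ? oR ⟩
        ≡⟨ cong (_+ ⟨ W , δ? oR ⟩) (⟨⟩-distrib-+ W a′ (δ? oL)) ⟨
      ⟨ W , (λ i → a′ i + δ? oL i) ⟩ + ⟨ W , δ? oR ⟩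
        ≡⟨ ⟨⟩-distrib-+ W (λ i → a′ i + δ? oL i) (δ? oR) ⟨
      ⟨ W , (λ i → a′ i + δ? oL i + δ? oR i) ⟩
        ≡⟨ ⟨⟩-cong W (moveAt-balance move pickL pickR) ⟩
      ⟨ W , (λ i → a i + (δ T i + δ T i)) ⟩
        ≡⟨ ⟨⟩-distrib-+ W a (λ i → δ T i + δ T i) ⟩
      Φ a + ⟨ W , (λ i → δ T i + δ T i) ⟩
        ≡⟨ cong (Φ a +_) (⟨⟩-distrib-+ W (δ T) (δ T)) ⟩
      Φ a + (⟨ W , δ T ⟩ + ⟨ W , δ T ⟩)
        ≡⟨ cong (λ x → Φ a + (x + x)) (⟨⟩-δ W T) ⟩
      Φ a + (W T + W T)
        ∎

  moveAt-entry≤ : ∀ i → a′ i ≤ a i ⊔ 2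
  moveAt-entry≤ i with i ≟ᶠ T | left | right
  ... | yes refl | _ | _ = subst (_≤ a T ⊔ 2) (sym (proj₁ (proj₂ move))) (m≤n⊔m (a T) 2)
  ... | no i≢T | oL , pickL | oR , pickR = begin
    a′ i                           ≤⟨ m≤m+n (a′ i) _ ⟩
    a′ i + (δ? oL i + δ? oR i)     ≡⟨ +-assoc (a′ i) _ _ ⟨
    a′ i + δ? oL i + δ? oR i       ≡⟨ moveAt-balance move pickL pickR i ⟩
    a i + (δ T i + δ T i)          ≡⟨ cong (λ x → a i + (x + x)) (δ-offDiag (≢-sym i≢T)) ⟩
    a i + 0                        ≡⟨ +-identityʳ (a i) ⟩
    a i                            ≤⟨ m≤m⊔n (a i) 2 ⟩
    a i ⊔ 2                        ∎
    where open ≤-Reasoning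

move-Φ< : ∀ {m} {a a′ : State m} → Move a a′ → Φ a < Φ a′
move-Φ< (_ , move) = moveAt-Φ< move

move-entry≤ : ∀ {m} {a a′ : State m} → Move a a′ → ∀ i → a′ i ≤ a i ⊔ 2
move-entry≤ (_ , move) = moveAt-entry≤ move

strictlyIncreasing⇒n≤f[n] : ∀ {f : ℕ → ℕ} → (∀ t → f t < f (suc t)) → ∀ t → t ≤ f t
strictlyIncreasing⇒n≤f[n] f↑ zero    = z≤n
strictlyIncreasing⇒n≤f[n] f↑ (suc t) = <-≤-trans (s≤s (strictlyIncreasing⇒n≤f[n] f↑ t)) (f↑ t)

moves-entry≤ : ∀ {m} (s : ℕ → State m) → (∀ t → Move (s t) (s (suc t))) →
  ∀ t i → s t i ≤ s 0 i ⊔ 2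
moves-entry≤ s moves zero    i = m≤m⊔n (s 0 i) 2
moves-entry≤ s moves (suc t) i =
  ≤-trans (move-entry≤ (moves t) i) (⊔-lub (moves-entry≤ s moves t i) (m≤n⊔m (s 0 i) 2))

mainTheorem1 : (m : ℕ) → 1 ≤ m → (a : State m) → ¬ InfiniteMoveSeq a
mainTheorem1 _ _ _ (s , _ , moves) = <-irrefl refl (begin-strict
  B              <⟨ n<1+n B ⟩
  suc B          ≤⟨ strictlyIncreasing⇒n≤f[n] (λ t → move-Φ< (moves t)) (suc B) ⟩
  Φ (s (suc B))  ≤⟨ ⟨⟩-monoʳ-≤ W (moves-entry≤ s moves (suc B)) ⟩
  B              ∎)
  where
  open ≤-Reasoning
  B : ℕ
  B = Φ (λ i → s 0 i ⊔ 2)
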